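{- Let $F$ be a polynomial functor built from constant functors, the identity, arbitrary products and binary coproducts, with evaluation maps $\Lambda^F$ defined recursively: for $F=B$ constant an arbitrary set of maps $B\to\mathcal{V}$; for $F=\mathrm{Id}$, $\{\mathrm{id}_\mathcal{V}\}$; for $F=\prod_{i\in I}F_i$, $\{\mathit{ev}_i\circ\pi'_i\mid i\in I,\mathit{ev}_i\in\Lambda^{F_i}\}$; for $F=F_1+F_2$, $\{[\mathit{ev}_1,\top]\}\cup\{[\bot,\mathit{ev}_2]\}\cup\{[\bot,\top]\}$. Then the Kantorovich lifting $d^F_X=\overline F(d_X)$ is: for constants $d^F_X(b,c)=\bigwedge_{\mathit{ev}\in\Lambda^F}d_\mathcal{V}(\mathit{ev}(b),\mathit{ev}(c))$; for the identity $d^F_X=\alpha_X(\gamma_X(d_X))$; for products $d^F_X(s,t)=\bigwedge_{i\in I}d^{F_i}_X(\pi_i(s),\pi_i(t))$; for coproducts $d^F_X(s,t)=d^{F_i}_X(s,t)$ if $s,t\in F_iX$, $\top$ if $s\in F_1X,t\in F_2X$, and $\bot$ if $s\in F_2X,t\in F_1X$.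
   Context: $\mathcal{V}$ is a quantale with order $\sqsubseteq$, meets $\bigwedge$, top $\top$, bottom $\bot$, residuation $d_\mathcal{V}$. The Kantorovich lifting is $\overline F(d_X)(s,t)=\bigwedge_{\mathit{ev}\in\Lambda^F}\bigwedge_{f\in\gamma_X(d_X)}d_\mathcal{V}(\mathit{ev}(Ff(s)),\mathit{ev}(Ff(t)))$, where $\gamma_X(d)=\{f\colon X\to\mathcal{V}\mid d\sqsubseteq d_\mathcal{V}\circ(f\times f)\}$ and $\alpha_X(S)(x_1,x_2)=\bigwedge_{f\in S}d_\mathcal{V}(f(x_1),f(x_2))$. -}

module Defs where

open import Data.Empty using () renaming (⊥ to Empty)
open import Data.Unit using () renaming (⊤ to Unit; tt to unit)
open import Data.Product using (Σ; _×_; _,_; proj₁; proj₂)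
open import Data.Sum using (_⊎_; inj₁; inj₂; [_,_])
import Data.Sum as Sum
open import Relation.Binary.PropositionalEquality using (_≡_)
open import Relation.Binary.Structures using (IsPartialOrder)

-- A (commutative, unital) quantale, presented as a complete lattice
-- (arbitrary meets over families indexed by any type in Set) together with
-- a tensor ⊗ that has a right adjoint dV (the residuation / internal hom):
--   a ⊗ c ⊑ b  iff  c ⊑ dV a b.
-- (Existence of the right adjoint is equivalent to ⊗ preserving arbitrary joins.)
record Quantale : Set₁ where
  infix 4 _⊑_
  infixl 7 _⊗_
  field
    V         : Set
    _⊑_       : V → V → Set
    isPartialOrder : IsPartialOrder _≡_ _⊑_
    ⋀         : {I : Set} → (I → V) → V
    ⋀-lb      : {I : Set} (g : I → V) (i : I) → ⋀ g ⊑ g i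
    ⋀-glb     : {I : Set} (g : I → V) (a : V) → ((i : I) → a ⊑ g i) → a ⊑ ⋀ g
    _⊗_       : V → V → V
    k         : V
    ⊗-assoc   : (a b c : V) → (a ⊗ b) ⊗ c ≡ a ⊗ (b ⊗ c)
    ⊗-comm    : (a b : V) → a ⊗ b ≡ b ⊗ a
    ⊗-identityˡ : (a : V) → k ⊗ a ≡ a
    dV        : V → V → V
    residual⇒ : (a b c : V) → a ⊗ c ⊑ b → c ⊑ dV a b
    residual⇐ : (a b c : V) → c ⊑ dV a b → a ⊗ c ⊑ b

  ⊤V : V
  ⊤V = ⋀ {Empty} (λ ())

  ⊥V : V
  ⊥V = ⋀ {V} (λ v → v)

module _ (Q : Quantale) where
  open Quantale Q

  data Poly : Set₁ where
    const  : (B : Set) (J : Set) (e : J → B → V) → Poly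
    idF    : Poly
    prodF  : (I : Set) → (I → Poly) → Poly
    coprod : Poly → Poly → Poly

  ⟦_⟧ : Poly → Set → Set
  ⟦ const B J e ⟧ X = B
  ⟦ idF ⟧ X = X
  ⟦ prodF I F ⟧ X = (i : I) → ⟦ F i ⟧ X
  ⟦ coprod F G ⟧ X = ⟦ F ⟧ X ⊎ ⟦ G ⟧ X

  fmap : (F : Poly) {X Y : Set} → (X → Y) → ⟦ F ⟧ X → ⟦ F ⟧ Y
  fmap (const B J e) f b = b
  fmap idF f x = f x
  fmap (prodF I F) f s = λ i → fmap (F i) f (s i)
  fmap (coprod F G) f s = Sum.map (fmap F f) (fmap G f) s

  -- Evaluation maps Λ^F, as an indexed family  ev F : Ev F → (F V → V)
  Ev : Poly → Set
  Ev (const B J e) = J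
  Ev idF = Unit
  Ev (prodF I F) = Σ I (λ i → Ev (F i))
  Ev (coprod F G) = Ev F ⊎ (Ev G ⊎ Unit)

  ev : (F : Poly) → Ev F → ⟦ F ⟧ V → V
  ev (const B J e) j b = e j b
  ev idF _ v = v
  ev (prodF I F) (i , j) s = ev (F i) j (s i)
  ev (coprod F G) (inj₁ j) = [ ev F j , (λ _ → ⊤V) ]
  ev (coprod F G) (inj₂ (inj₁ j)) = [ (λ _ → ⊥V) , ev G j ]
  ev (coprod F G) (inj₂ (inj₂ _)) = [ (λ _ → ⊥V) , (λ _ → ⊤V) ]

  γ : {X : Set} → (X → X → V) → Set
  γ {X} d = Σ (X → V) (λ f → (x y : X) → d x y ⊑ dV (f x) (f y))

  α : {X : Set} {S : Set} → (S → X → V) → X → X → V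
  α fs x₁ x₂ = ⋀ (λ s → dV (fs s x₁) (fs s x₂))

  Kant : (F : Poly) {X : Set} → (X → X → V) → ⟦ F ⟧ X → ⟦ F ⟧ X → V
  Kant F d s t =
    ⋀ {Ev F × γ d} (λ p →
      dV (ev F (proj₁ p) (fmap F (proj₁ (proj₂ p)) s))
         (ev F (proj₁ p) (fmap F (proj₁ (proj₂ p)) t)))

{-# OPTIONS --safe #-}
module Submission where

-- Every case is a comparison of two meets, settled by matching their index
-- families.  Two facts about the quantale do the real work: the residuation
-- dV ⊥ b and dV a ⊤ are ⊤, so the evaluation maps [ev₁, ⊤] and [⊥, ev₂]
-- contribute nothing outside their own summand, while dV ⊤ ⊥ = ⊥, so the map
-- [⊥, ⊤] forces distance ⊥ from the right summand to the left one.  Finally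
-- γ d is never empty, because the constant map ⊥ is nonexpansive for every d;
-- this is needed whenever the integrand does not depend on the test function.

open import Defs
open import Data.Product using (Σ; _×_; _,_; proj₁)
open import Data.Sum using (inj₁; inj₂)
open import Data.Unit using () renaming (tt to unit)
open import Relation.Binary.Bundles using (Poset)
open import Relation.Binary.PropositionalEquality using (_≡_; sym) renaming (trans to ≡-trans)
open import Relation.Binary.Structures using (IsPartialOrder)

module _ (Q : Quantale) where
  open Quantale Q
  open IsPartialOrder isPartialOrder using (antisym; reflexive; trans)
    renaming (refl to ⊑-refl)

  poset : Poset _ _ _
  poset = record { isPartialOrder = isPartialOrder }

  open import Relation.Binary.Reasoning.PartialOrder poset

  ⊑-⊤ : (a : V) → a ⊑ ⊤V
  ⊑-⊤ a = ⋀-glb _ a (λ ())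

  ⊥-⊑ : (a : V) → ⊥V ⊑ a
  ⊥-⊑ a = ⋀-lb (λ v → v) a

  ⊗-monoʳ-⊑ : (c : V) {a b : V} → a ⊑ b → c ⊗ a ⊑ c ⊗ b
  ⊗-monoʳ-⊑ c {a} {b} a⊑b =
    residual⇐ c (c ⊗ b) a (trans a⊑b (residual⇒ c (c ⊗ b) b ⊑-refl))

  ⊑-⊤⊗ : (a : V) → a ⊑ ⊤V ⊗ a
  ⊑-⊤⊗ a = begin
    a       ≡⟨ sym (⊗-identityˡ a) ⟩
    k ⊗ a   ≡⟨ ⊗-comm k a ⟩
    a ⊗ k   ≤⟨ ⊗-monoʳ-⊑ a (⊑-⊤ k) ⟩
    a ⊗ ⊤V  ≡⟨ ⊗-comm a ⊤V ⟩
    ⊤V ⊗ a  ∎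

  ⊑-dV-⊥ˡ : (c b : V) → c ⊑ dV ⊥V b
  ⊑-dV-⊥ˡ c b = residual⇒ ⊥V b c (begin
    ⊥V ⊗ c  ≡⟨ ⊗-comm ⊥V c ⟩
    c ⊗ ⊥V  ≤⟨ residual⇐ c b ⊥V (⊥-⊑ (dV c b)) ⟩
    b       ∎)

  ⊑-dV-⊤ʳ : (c a : V) → c ⊑ dV a ⊤V
  ⊑-dV-⊤ʳ c a = residual⇒ a ⊤V c (⊑-⊤ (a ⊗ c))

  dV-⊤-⊥ : dV ⊤V ⊥V ⊑ ⊥V
  dV-⊤-⊥ = trans (⊑-⊤⊗ (dV ⊤V ⊥V)) (residual⇐ ⊤V ⊥V (dV ⊤V ⊥V) ⊑-refl)

  ⋀-≡ : {I J : Set} {g : I → V} {h : J → V} →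
        ((j : J) → ⋀ g ⊑ h j) → ((i : I) → ⋀ h ⊑ g i) → ⋀ g ≡ ⋀ h
  ⋀-≡ {g = g} {h} g⊑h h⊑g = antisym (⋀-glb h (⋀ g) g⊑h) (⋀-glb g (⋀ h) h⊑g)

  ⋀-≡-reindex : {I J : Set} {g : I → V} {h : J → V} (r : J → I) (r′ : I → J) →
                ((j : J) → g (r j) ⊑ h j) → ((i : I) → h (r′ i) ⊑ g i) →
                ⋀ g ≡ ⋀ h
  ⋀-≡-reindex {g = g} {h} r r′ g⊑h h⊑g =
    ⋀-≡ (λ j → trans (⋀-lb g (r j)) (g⊑h j)) (λ i → trans (⋀-lb h (r′ i)) (h⊑g i))

  ⋀-Σ : {I : Set} {A : I → Set} (g : Σ I A → V) →
        ⋀ g ≡ ⋀ (λ i → ⋀ (λ a → g (i , a)))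
  ⋀-Σ g = ⋀-≡
    (λ i → ⋀-glb _ (⋀ g) (λ a → ⋀-lb g (i , a)))
    (λ { (i , a) → trans (⋀-lb _ i) (⋀-lb _ a) })

  const⊥∈γ : {X : Set} (d : X → X → V) → γ Q d
  const⊥∈γ d = (λ _ → ⊥V) , (λ x y → ⊑-dV-⊥ˡ (d x y) ⊥V)

  module _ {X : Set} (d : X → X → V) where

    Kant-const : {B J : Set} (e : J → B → V) (b c : B) →
                 Kant Q (const B J e) d b c ≡ ⋀ (λ j → dV (e j b) (e j c))
    Kant-const e b c = ⋀-≡-reindex (λ j → j , const⊥∈γ d) proj₁
      (λ _ → ⊑-refl) (λ _ → ⊑-refl)

    Kant-id : (s t : X) → Kant Q (idF {Q}) d s t ≡ α Q {S = γ Q d} proj₁ s t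
    Kant-id s t = ⋀-≡-reindex (λ f → unit , f) (λ { (_ , f) → f })
      (λ _ → ⊑-refl) (λ _ → ⊑-refl)

    Kant-prod : {I : Set} (F : I → Poly Q) (s t : ⟦_⟧ Q (prodF I F) X) →
                Kant Q (prodF I F) d s t ≡ ⋀ (λ i → Kant Q (F i) d (s i) (t i))
    Kant-prod F s t = ≡-trans
      (⋀-≡-reindex (λ { (i , j , f) → (i , j) , f }) (λ { ((i , j) , f) → i , j , f })
        (λ _ → ⊑-refl) (λ _ → ⊑-refl))
      (⋀-Σ _)

    module _ (F G : Poly Q) where

      Kant-inj₁-inj₁ : (s t : ⟦_⟧ Q F X) →
                       Kant Q (coprod F G) d (inj₁ s) (inj₁ t) ≡ Kant Q F d s t
      Kant-inj₁-inj₁ s t = ⋀-≡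
        (λ { (j , f) → ⋀-lb _ (inj₁ j , f) })
        (λ { (inj₁ j , f)        → ⋀-lb _ (j , f)
           ; (inj₂ (inj₁ _) , _) → ⊑-dV-⊥ˡ _ _
           ; (inj₂ (inj₂ _) , _) → ⊑-dV-⊥ˡ _ _ })

      Kant-inj₂-inj₂ : (s t : ⟦_⟧ Q G X) →
                       Kant Q (coprod F G) d (inj₂ s) (inj₂ t) ≡ Kant Q G d s t
      Kant-inj₂-inj₂ s t = ⋀-≡
        (λ { (j , f) → ⋀-lb _ (inj₂ (inj₁ j) , f) })
        (λ { (inj₁ _ , _)        → ⊑-dV-⊤ʳ _ _
           ; (inj₂ (inj₁ j) , f) → ⋀-lb _ (j , f)
           ; (inj₂ (inj₂ _) , _) → ⊑-dV-⊤ʳ _ _ })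

      Kant-inj₁-inj₂ : (s : ⟦_⟧ Q F X) (t : ⟦_⟧ Q G X) →
                       Kant Q (coprod F G) d (inj₁ s) (inj₂ t) ≡ ⊤V
      Kant-inj₁-inj₂ s t = ⋀-≡ (λ ())
        (λ { (inj₁ _ , _)        → ⊑-dV-⊤ʳ _ _
           ; (inj₂ (inj₁ _) , _) → ⊑-dV-⊥ˡ _ _
           ; (inj₂ (inj₂ _) , _) → ⊑-dV-⊥ˡ _ _ })

      Kant-inj₂-inj₁ : (s : ⟦_⟧ Q G X) (t : ⟦_⟧ Q F X) →
                       Kant Q (coprod F G) d (inj₂ s) (inj₁ t) ≡ ⊥V
      Kant-inj₂-inj₁ s t = antisym
        (trans (⋀-lb _ (inj₂ (inj₂ unit) , const⊥∈γ d)) dV-⊤-⊥)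
        (⊥-⊑ _)

mainTheorem8 : (Q : Quantale) → let open Quantale Q in
    ((B J : Set) (e : J → B → V) (X : Set) (d : X → X → V) (b c : B) →
    Kant Q (const B J e) d b c ≡ ⋀ (λ j → dV (e j b) (e j c)))
    × ((X : Set) (d : X → X → V) (s t : X) →
    Kant Q (idF {Q}) d s t ≡ α Q {S = γ Q d} proj₁ s t)
    × ((I : Set) (F : I → Poly Q) (X : Set) (d : X → X → V) (s t : ⟦_⟧ Q (prodF I F) X) →
    Kant Q (prodF I F) d s t ≡ ⋀ (λ i → Kant Q (F i) d (s i) (t i)))
    × ((F G : Poly Q) (X : Set) (d : X → X → V) →
    ((s t : ⟦_⟧ Q F X) → Kant Q (coprod F G) d (inj₁ s) (inj₁ t) ≡ Kant Q F d s t)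
    × ((s t : ⟦_⟧ Q G X) → Kant Q (coprod F G) d (inj₂ s) (inj₂ t) ≡ Kant Q G d s t)
    × ((s : ⟦_⟧ Q F X) (t : ⟦_⟧ Q G X) → Kant Q (coprod F G) d (inj₁ s) (inj₂ t) ≡ ⊤V)
    × ((s : ⟦_⟧ Q G X) (t : ⟦_⟧ Q F X) → Kant Q (coprod F G) d (inj₂ s) (inj₁ t) ≡ ⊥V))
mainTheorem8 Q =
    (λ B J e X d → Kant-const Q d e)
  , (λ X d → Kant-id Q d)
  , (λ I F X d → Kant-prod Q d F)
  , (λ F G X d → Kant-inj₁-inj₁ Q d F G , Kant-inj₂-inj₂ Q d F G
               , Kant-inj₁-inj₂ Q d F G , Kant-inj₂-inj₁ Q d F G)
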